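{- If an integer $n$ is prime partitionable, then $n$ is an Erdős–Woods number (both notions as defined in the context below).
   Context: A positive integer $w$ is an Erdős–Woods number if there exist positive integers $e_1<e_2$ with $w=e_2-e_1$ such that every integer $k$ with $e_1\le k\le e_2$ satisfies $\gcd(k,e_1)>1$ or $\gcd(k,e_2)>1$. An integer $n$ is called prime partitionable if there is a partition $\{\mathbb{P}_1,\mathbb{P}_2\}$ of the set of all primes less than $n$ into two nonempty disjoint sets such that for all positive integers $n_1,n_2$ with $n_1+n_2=n$ there is some pair $(p_1,p_2)\in\mathbb{P}_1\times\mathbb{P}_2$ with $\gcd(n_1,p_1)>1$ or $\gcd(n_2,p_2)>1$. -}

module Defs where

open import Data.Nat using (ℕ; suc; _+_; _∸_; _≤_; _<_)
open import Data.Nat.GCD using (gcd)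
open import Data.Nat.Primality using (Prime)
open import Data.Bool using (Bool; true; false)
open import Data.Product using (Σ; ∃; _×_; ∃-syntax)
open import Data.Sum using (_⊎_)
open import Relation.Binary.PropositionalEquality using (_≡_)

ErdosWoods : ℕ → Set
ErdosWoods w =
  (0 < w) ×
  ∃[ e₁ ] ∃[ e₂ ]
    (0 < e₁) × (e₁ < e₂) × (w ≡ e₂ ∸ e₁) ×
    (∀ k → e₁ ≤ k → k ≤ e₂ → (1 < gcd k e₁) ⊎ (1 < gcd k e₂))

-- A partition {ℙ₁, ℙ₂} of the primes less than n is encoded by a colouring
-- c : ℕ → Bool: a prime p < n lies in ℙ₁ iff c p ≡ true, in ℙ₂ iff c p ≡ false
-- (values of c at non-primes or at p ≥ n are irrelevant).
InP₁ : ℕ → (ℕ → Bool) → ℕ → Set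
InP₁ n c p = Prime p × (p < n) × (c p ≡ true)

InP₂ : ℕ → (ℕ → Bool) → ℕ → Set
InP₂ n c p = Prime p × (p < n) × (c p ≡ false)

PrimePartitionable : ℕ → Set
PrimePartitionable n =
  Σ (ℕ → Bool) λ c →
    (∃[ p ] InP₁ n c p) × (∃[ p ] InP₂ n c p) ×
    (∀ n₁ n₂ → 0 < n₁ → 0 < n₂ → n₁ + n₂ ≡ n →
      ∃[ p₁ ] ∃[ p₂ ] InP₁ n c p₁ × InP₂ n c p₂ ×
        ((1 < gcd n₁ p₁) ⊎ (1 < gcd n₂ p₂)))

module Submission where

-- Let ℙ₁, ℙ₂ be the two colour classes of primes below n and A, B their
-- products.  The classes are disjoint, so A and B are coprime and Bézout
-- (a Chinese-remainder step) gives e > 0 with A ∣ e and B ∣ e + n; we take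
-- e₁ = e and e₂ = e + n.  Each k in [e, e + n] splits the gap as k = e + n₁,
-- e + n = k + n₂ with n₁ + n₂ = n.  At the endpoints gcd(k,k) = k is divisible
-- by a prime of the nonempty class ℙ₁ resp. ℙ₂.  Inside, the partition
-- condition gives p₁ ∈ ℙ₁ dividing n₁ (hence k = e + n₁ and e) or p₂ ∈ ℙ₂
-- dividing n₂ (hence k and e + n).

open import Defs
open import Data.Nat using (ℕ; zero; suc; _+_; _*_; _≤_; _<_; z≤n; z<s; ≢-nonZero; ≢-nonZero⁻¹; nonTrivial⇒n>1)
open import Data.Nat.Properties
open import Data.Nat.Divisibility
open import Data.Nat.GCD using (gcd; gcd-greatest; gcd[m,n]∣m; gcd[m,n]∣n; gcd[m,n]≢0; module Bézout)
open import Data.Nat.Coprimality using (Coprime; coprime-Bézout)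
open import Data.Nat.Primality using (Prime; prime; prime?; prime⇒irreducible; productOfPrimes≢0; productOfPrimes≥1)
open import Data.Nat.Primality.Factorisation using (PrimeFactorisation; factorise; factorisationHasAllPrimeFactors)
open import Data.Nat.ListAction using (product)
open import Data.Nat.ListAction.Properties using (∈⇒∣product)
open import Data.Bool using (Bool; true; false)
import Data.Bool as Bool
open import Data.List using (List; []; _∷_; filter; upTo)
open import Data.List.Relation.Unary.All as All using (All)
open import Data.List.Relation.Unary.Any using (here)
open import Data.List.Membership.Propositional using (_∈_; _∉_)
open import Data.List.Membership.Propositional.Properties using (∈-filter⁺; ∈-filter⁻; ∈-upTo⁺)
open import Data.Product using (_×_; _,_; proj₁; proj₂; ∃-syntax)
open import Data.Sum using (_⊎_; inj₁; inj₂)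
open import Relation.Nullary using (contradiction)
open import Relation.Nullary.Decidable using (_×-dec_)
open import Relation.Unary using (Decidable)
open import Relation.Binary.PropositionalEquality
open import Data.Nat.Solver using (module +-*-Solver)
open +-*-Solver using (solve; _:+_; _:*_; _:=_; con)

common-prime⇒gcd>1 : ∀ {p a b} → Prime p → p ∣ a → p ∣ b → 0 < b → 1 < gcd a b
common-prime⇒gcd>1 {p} {a} {b} p-prime@(prime _) p∣a p∣b b>0 =
  <-≤-trans (nonTrivial⇒n>1 p) (∣⇒≤ {{≢-nonZero gcd≢0}} (gcd-greatest p∣a p∣b))
  where
  gcd≢0 : gcd a b ≢ 0
  gcd≢0 = gcd[m,n]≢0 a b (inj₂ (>⇒≢ b>0))

gcd>1⇒prime∣ : ∀ {a p} → Prime p → 1 < gcd a p → p ∣ a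
gcd>1⇒prime∣ {a} {p} p-prime g>1 with prime⇒irreducible p-prime (gcd[m,n]∣n a p)
... | inj₁ g≡1 = contradiction g≡1 (>⇒≢ g>1)
... | inj₂ g≡p = subst (_∣ a) g≡p (gcd[m,n]∣m a p)

interval-split : ∀ {e k n} → e ≤ k → k ≤ e + n →
  ∃[ n₁ ] ∃[ n₂ ] e + n₁ ≡ k × n₁ + n₂ ≡ n
interval-split {e} {k} {n} e≤k k≤e+n
  with m≤n⇒∃[o]m+o≡n e≤k | m≤n⇒∃[o]m+o≡n k≤e+n
... | n₁ , e+n₁≡k | n₂ , k+n₂≡e+n = n₁ , n₂ , e+n₁≡k , +-cancelˡ-≡ e _ _ (begin
  e + (n₁ + n₂)  ≡⟨ +-assoc e n₁ n₂ ⟨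
  e + n₁ + n₂    ≡⟨ cong (_+ n₂) e+n₁≡k ⟩
  k + n₂         ≡⟨ k+n₂≡e+n ⟩
  e + n          ∎)
  where open ≡-Reasoning

-- Products of two lists of primes with no prime in common are coprime:
-- a common divisor d has all its prime factors in both lists, so it has
-- none, i.e. d = 1.
disjoint-primes⇒coprime-products : ∀ {as bs} → All Prime as → All Prime bs →
  (∀ {p} → p ∈ as → p ∉ bs) → Coprime (product as) (product bs)
disjoint-primes⇒coprime-products {as} {bs} as-prime bs-prime disjoint {d} (d∣A , d∣B)
  with PrimeFactorisation.factors factorisation
     | PrimeFactorisation.isFactorisation factorisation
     | PrimeFactorisation.factorsPrime factorisation
  where
  d≢0 : d ≢ 0
  d≢0 refl = ≢-nonZero⁻¹ (product as) {{productOfPrimes≢0 as-prime}} (0∣⇒≡0 d∣A)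
  factorisation : PrimeFactorisation d
  factorisation = factorise d {{≢-nonZero d≢0}}
... | [] | d≡1 | _ = d≡1
... | q ∷ qs | d≡Πfs | q-prime All.∷ _ = contradiction q∈bs (disjoint q∈as)
  where
  q∣d : q ∣ d
  q∣d = subst (q ∣_) (sym d≡Πfs) (∈⇒∣product {ns = q ∷ qs} (here refl))
  q∈as : q ∈ as
  q∈as = factorisationHasAllPrimeFactors q-prime (∣-trans q∣d d∣A) as-prime
  q∈bs : q ∈ bs
  q∈bs = factorisationHasAllPrimeFactors q-prime (∣-trans q∣d d∣B) bs-prime

negative-inverse : ∀ {A B} → 0 < B → Coprime A B → ∃[ y ] B ∣ A * y + 1
negative-inverse {A} {suc B′} _ A⊥B with coprime-Bézout A⊥B
... | Bézout.-+ x y 1+xA≡yB = x , divides y (begin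
  A * x + 1   ≡⟨ solve 2 (λ A x → A :* x :+ con 1 := con 1 :+ x :* A) refl A x ⟩
  1 + x * A   ≡⟨ 1+xA≡yB ⟩
  y * suc B′  ∎)
  where open ≡-Reasoning
... | Bézout.+- x y 1+yB≡xA = x * B′ , divides (1 + y * B′) (begin
  A * (x * B′) + 1            ≡⟨ solve 3 (λ A x B′ → A :* (x :* B′) :+ con 1 := x :* A :* B′ :+ con 1) refl A x B′ ⟩
  x * A * B′ + 1              ≡⟨ cong (λ t → t * B′ + 1) 1+yB≡xA ⟨
  (1 + y * suc B′) * B′ + 1   ≡⟨ solve 2 (λ y B′ → (con 1 :+ y :* (con 1 :+ B′)) :* B′ :+ con 1
                                                 := (con 1 :+ y :* B′) :* (con 1 :+ B′)) refl y B′ ⟩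
  (1 + y * B′) * suc B′       ∎)
  where open ≡-Reasoning

-- Chinese-remainder step: for coprime A, B > 0 and any n, some positive
-- multiple e of A has e + n divisible by B.  Take e = A (n y + B) with
-- B ∣ A y + 1; then e + n = n (A y + 1) + A B.
shifted-multiple : ∀ {A B} → 0 < A → 0 < B → Coprime A B → ∀ n →
  ∃[ e ] 0 < e × A ∣ e × B ∣ e + n
shifted-multiple {A} {B} A>0 B>0 A⊥B n with negative-inverse B>0 A⊥B
... | y , B∣Ay+1 = A * m , *-mono-< A>0 m>0 , m∣m*n m , B∣e+n
  where
  m : ℕ
  m = n * y + B
  m>0 : 0 < m
  m>0 = <-≤-trans B>0 (m≤n+m B (n * y))
  e+n≡ : A * m + n ≡ n * (A * y + 1) + A * B
  e+n≡ = solve 4 (λ A n y B → A :* (n :* y :+ B) :+ n := n :* (A :* y :+ con 1) :+ A :* B) refl A n y B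
  B∣e+n : B ∣ A * m + n
  B∣e+n = subst (B ∣_) (sym e+n≡) (∣m∣n⇒∣m+n (∣n⇒∣m*n n B∣Ay+1) (n∣m*n A))

ColouredPrime : ℕ → (ℕ → Bool) → Bool → ℕ → Set
ColouredPrime n c b p = Prime p × p < n × c p ≡ b

primeOfColour? : ∀ (c : ℕ → Bool) b → Decidable (λ q → Prime q × c q ≡ b)
primeOfColour? c b q = prime? q ×-dec (c q Bool.≟ b)

colourClass : ℕ → (ℕ → Bool) → Bool → List ℕ
colourClass n c b = filter (primeOfColour? c b) (upTo n)

colourClass-primes : ∀ n c b → All Prime (colourClass n c b)
colourClass-primes n c b =
  All.tabulate (λ q∈ → proj₁ (proj₂ (∈-filter⁻ (primeOfColour? c b) {xs = upTo n} q∈)))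

colourClass-complete : ∀ {n c b p} → ColouredPrime n c b p → p ∈ colourClass n c b
colourClass-complete (p-prime , p<n , cp≡b) =
  ∈-filter⁺ (primeOfColour? _ _) (∈-upTo⁺ p<n) (p-prime , cp≡b)

colourClasses-disjoint : ∀ {n c p} → p ∈ colourClass n c true → p ∉ colourClass n c false
colourClasses-disjoint {n} {c} p∈ℙ₁ p∈ℙ₂
  with ∈-filter⁻ (primeOfColour? c true) {xs = upTo n} p∈ℙ₁
     | ∈-filter⁻ (primeOfColour? c false) {xs = upTo n} p∈ℙ₂
... | _ , _ , cp≡true | _ , _ , cp≡false = contradiction (trans (sym cp≡true) cp≡false) (λ ())

classProduct : ℕ → (ℕ → Bool) → Bool → ℕ
classProduct n c b = product (colourClass n c b)

classProduct-positive : ∀ n c b → 0 < classProduct n c b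
classProduct-positive n c b = productOfPrimes≥1 (colourClass-primes n c b)

classProduct-divisible : ∀ {n c b p} → ColouredPrime n c b p → p ∣ classProduct n c b
classProduct-divisible p-coloured = ∈⇒∣product (colourClass-complete p-coloured)

classProducts-coprime : ∀ n c → Coprime (classProduct n c true) (classProduct n c false)
classProducts-coprime n c = disjoint-primes⇒coprime-products
  (colourClass-primes n c true) (colourClass-primes n c false) (colourClasses-disjoint {n} {c})

Separating : ℕ → (ℕ → Bool) → Set
Separating n c = ∀ n₁ n₂ → 0 < n₁ → 0 < n₂ → n₁ + n₂ ≡ n →
  ∃[ p₁ ] ∃[ p₂ ] InP₁ n c p₁ × InP₂ n c p₂ × ((1 < gcd n₁ p₁) ⊎ (1 < gcd n₂ p₂))

module Window {n : ℕ} {c : ℕ → Bool}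
  {p : ℕ} (p∈ℙ₁ : InP₁ n c p) {q : ℕ} (q∈ℙ₂ : InP₂ n c q)
  (separating : Separating n c)
  {e : ℕ} (e>0 : 0 < e)
  (ℙ₁∣e : ∀ {r} → InP₁ n c r → r ∣ e) (ℙ₂∣e+n : ∀ {r} → InP₂ n c r → r ∣ e + n)
  where

  e+n>0 : 0 < e + n
  e+n>0 = <-≤-trans e>0 (m≤m+n e n)

  covered : ∀ n₁ n₂ → n₁ + n₂ ≡ n → (1 < gcd (e + n₁) e) ⊎ (1 < gcd (e + n₁) (e + n))
  covered zero n₂ _ =
    inj₁ (common-prime⇒gcd>1 {a = e + 0} (proj₁ p∈ℙ₁)
           (subst (p ∣_) (sym (+-identityʳ e)) (ℙ₁∣e p∈ℙ₁)) (ℙ₁∣e p∈ℙ₁) e>0)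
  covered n₁@(suc _) zero n₁+0≡n =
    inj₂ (common-prime⇒gcd>1 {a = e + n₁} (proj₁ q∈ℙ₂)
           (subst (λ t → q ∣ e + t) n₁≡n (ℙ₂∣e+n q∈ℙ₂)) (ℙ₂∣e+n q∈ℙ₂) e+n>0)
    where
    n₁≡n : n ≡ n₁
    n₁≡n = trans (sym n₁+0≡n) (+-identityʳ n₁)
  covered n₁@(suc _) n₂@(suc _) n₁+n₂≡n with separating n₁ n₂ z<s z<s n₁+n₂≡n
  ... | p₁ , _ , p₁∈ℙ₁@(p₁-prime , _) , _ , inj₁ gcd[n₁,p₁]>1 =
    inj₁ (common-prime⇒gcd>1 {a = e + n₁} p₁-prime
           (∣m∣n⇒∣m+n (ℙ₁∣e p₁∈ℙ₁) (gcd>1⇒prime∣ {a = n₁} p₁-prime gcd[n₁,p₁]>1))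
           (ℙ₁∣e p₁∈ℙ₁) e>0)
  ... | _ , p₂ , _ , p₂∈ℙ₂@(p₂-prime , _) , inj₂ gcd[n₂,p₂]>1 =
    inj₂ (common-prime⇒gcd>1 {a = e + n₁} p₂-prime
           (∣m+n∣m⇒∣n (subst (p₂ ∣_) e+n≡n₂+k (ℙ₂∣e+n p₂∈ℙ₂))
                      (gcd>1⇒prime∣ {a = n₂} p₂-prime gcd[n₂,p₂]>1))
           (ℙ₂∣e+n p₂∈ℙ₂) e+n>0)
    where
    e+n≡n₂+k : e + n ≡ n₂ + (e + n₁)
    e+n≡n₂+k = begin
      e + n          ≡⟨ cong (e +_) n₁+n₂≡n ⟨
      e + (n₁ + n₂)  ≡⟨ solve 3 (λ e n₁ n₂ → e :+ (n₁ :+ n₂) := n₂ :+ (e :+ n₁)) refl e n₁ n₂ ⟩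
      n₂ + (e + n₁)  ∎
      where open ≡-Reasoning

  -- Every k in [e, e + n] is such a point; n > 0 as ℙ₁ has a prime p < n.
  erdosWoods : ErdosWoods n
  erdosWoods = n>0 , e , e + n , e>0 , m<m+n e n>0 , sym (m+n∸m≡n e n) , window-covered
    where
    n>0 : 0 < n
    n>0 = ≤-<-trans z≤n (proj₁ (proj₂ p∈ℙ₁))
    window-covered : ∀ k → e ≤ k → k ≤ e + n → (1 < gcd k e) ⊎ (1 < gcd k (e + n))
    window-covered k e≤k k≤e+n with interval-split e≤k k≤e+n
    ... | n₁ , n₂ , refl , n₁+n₂≡n = covered n₁ n₂ n₁+n₂≡n

lemma4 : (n : ℕ) → PrimePartitionable n → ErdosWoods n
lemma4 n (c , (_ , p∈ℙ₁) , (_ , q∈ℙ₂) , separating)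
  with shifted-multiple (classProduct-positive n c true) (classProduct-positive n c false)
                        (classProducts-coprime n c) n
... | e , e>0 , A∣e , B∣e+n =
  Window.erdosWoods p∈ℙ₁ q∈ℙ₂ separating e>0
    (λ r∈ℙ₁ → ∣-trans (classProduct-divisible r∈ℙ₁) A∣e)
    (λ r∈ℙ₂ → ∣-trans (classProduct-divisible r∈ℙ₂) B∣e+n)
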